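{- Let $F$ be a finite field and $n$ a positive integer. Then $\mathcal{D}=\{D_k(a_1,\ldots,a_{n-1}) : 1\leq k\leq n,\ a_1,\dots,a_{n-1}\in F\}$ is an independent set of the unitary Cayley graph $\Gamma(M_n(F))$.
   Context: For $1\leq k,l\leq n$ and $a_1,\dots,a_{n-1}\in F$, $D_{k,l}(a_1,\ldots,a_{n-1})$ denotes the $n\times n$ matrix over $F$ whose $(i,j)$ entry is $a_{i-l}$ if $j-i\equiv k \pmod n$ and $i\neq l$, and $0$ otherwise; all indices are taken modulo $n$ with representatives in $\{1,\dots,n\}$ (so $0$ is replaced by $n$). Set $D_k(a_1,\ldots,a_{n-1})=D_{k,k}(a_1,\ldots,a_{n-1})$. The unitary Cayley graph $\Gamma(M_n(F))$ has vertex set $M_n(F)$, with distinct $X,Y$ adjacent iff $X-Y$ is invertible. -}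

module Defs where

open import Level using (Level; _⊔_)
open import Algebra.Bundles using (CommutativeRing)
open import Data.Nat using (ℕ; zero; suc; _∸_) renaming (_+_ to _+ℕ_)
open import Data.Nat.DivMod using (_mod_)
open import Data.Fin using (Fin; toℕ) renaming (zero to fzero; suc to fsuc)
open import Data.Fin.Properties using () renaming (_≟_ to _≟ᶠ_)
open import Data.Product using (Σ; ∃; _×_)
open import Relation.Nullary using (¬_; yes; no)

module _ {c ℓ : Level} (R : CommutativeRing c ℓ) where
  open CommutativeRing R

  record IsField : Set (c ⊔ ℓ) where
    field
      1≉0 : ¬ (1# ≈ 0#)
      inverse : ∀ x → ¬ (x ≈ 0#) → ∃ λ y → (x * y) ≈ 1#

  IsFinite : Set (c ⊔ ℓ)
  IsFinite = Σ ℕ λ m → Σ (Fin m → Carrier) λ f → ∀ x → ∃ λ i → f i ≈ x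

  -- n × n matrices over R (rows/columns indexed by Fin n; index i stands for i+1).
  Mat : ℕ → Set c
  Mat n = Fin n → Fin n → Carrier

  _≈ᴹ_ : ∀ {n} → Mat n → Mat n → Set ℓ
  X ≈ᴹ Y = ∀ i j → X i j ≈ Y i j

  _-ᴹ_ : ∀ {n} → Mat n → Mat n → Mat n
  (X -ᴹ Y) i j = X i j - Y i j

  ∑ : ∀ {n} → (Fin n → Carrier) → Carrier
  ∑ {zero} f = 0#
  ∑ {suc n} f = f fzero + ∑ (λ i → f (fsuc i))

  _*ᴹ_ : ∀ {n} → Mat n → Mat n → Mat n
  (X *ᴹ Y) i j = ∑ (λ t → X i t * Y t j)

  Iᴹ : ∀ {n} → Mat n
  Iᴹ i j with i ≟ᶠ j
  ... | yes _ = 1#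
  ... | no _ = 0#

  Invertible : ∀ {n} → Mat n → Set (c ⊔ ℓ)
  Invertible {n} X = ∃ λ (Y : Mat n) → ((X *ᴹ Y) ≈ᴹ Iᴹ) × ((Y *ᴹ X) ≈ᴹ Iᴹ)

  Adjacent : ∀ {n} → Mat n → Mat n → Set (c ⊔ ℓ)
  Adjacent X Y = ¬ (X ≈ᴹ Y) × Invertible (X -ᴹ Y)

  IsIndependent : ∀ n → (Mat n → Set (c ⊔ ℓ)) → Set (c ⊔ ℓ)
  IsIndependent n S = ∀ X Y → S X → S Y → ¬ Adjacent X Y

  -- a_r for r ∈ {1,…,m} (r given as a Fin (suc m) residue); residue 0 never used.
  idx : ∀ {m} → (Fin m → Carrier) → Fin (suc m) → Carrier
  idx a fzero = 0#
  idx a (fsuc r) = a r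

  -- D_{k,l}(a_1,…,a_{n-1}) with n = suc m; a r (r : Fin m) stands for a_{r+1},
  -- k, l, i, j : Fin n stand for k+1, l+1, i+1, j+1.
  Dkl : ∀ m → Fin (suc m) → Fin (suc m) → (Fin m → Carrier) → Mat (suc m)
  Dkl m k l a i j with i ≟ᶠ l
  ... | yes _ = 0#
  ... | no _ with ((suc m +ℕ toℕ j) ∸ toℕ i) mod (suc m) ≟ᶠ (suc (toℕ k)) mod (suc m)
  ... | yes _ = idx a (((suc m +ℕ toℕ i) ∸ toℕ l) mod (suc m))
  ... | no _ = 0#

  Dk : ∀ m → Fin (suc m) → (Fin m → Carrier) → Mat (suc m)
  Dk m k a = Dkl m k k a

  In𝒟 : ∀ m → Mat (suc m) → Set (c ⊔ ℓ)
  In𝒟 m X = ∃ λ (k : Fin (suc m)) → ∃ λ (a : Fin m → Carrier) → X ≈ᴹ Dk m k a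

{-# OPTIONS --safe #-}
-- Row k of D_k(a) vanishes, and every other row i of D_k(a) is supported on the single
-- column i + k (indices 1-based, mod n). Hence rows k and k' of D_k(a) - D_{k'}(b) are
-- both supported on column k + k': if k = k' the row k is zero, otherwise two distinct
-- rows are proportional. Either way the difference has no right inverse, as long as 1 ≠ 0.
module Submission where

open import Defs
open import Level using (Level)
open import Algebra.Bundles using (CommutativeRing)
open import Data.Nat as ℕ using (ℕ; suc; zero; NonZero; _+_; _∸_; _%_; _<_)
open import Data.Nat.Properties using (+-comm; +-suc; m≤m+n; m+[n∸m]≡n; ≤-trans; <⇒≤)
open import Data.Nat.DivMod using (_mod_; %-distribˡ-+; [m+n]%n≡m%n; m<n⇒m%n≡m; m%n<n)
open import Data.Fin using (Fin; toℕ) renaming (zero to fzero; suc to fsuc)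
open import Data.Fin.Properties using (toℕ-fromℕ<; toℕ-injective; toℕ<n; suc-injective)
  renaming (_≟_ to _≟ᶠ_)
open import Data.Product using (_,_)
open import Data.Empty using (⊥-elim)
open import Relation.Nullary using (¬_; yes; no)
open import Relation.Binary.PropositionalEquality as ≡ using (_≡_; _≢_; ≢-sym)
open import Function using (_∘_)

toℕ-mod : ∀ m n .{{_ : NonZero n}} → toℕ (m mod n) ≡ m % n
toℕ-mod m n = toℕ-fromℕ< (m%n<n m n)

[n+j∸i]%n≡s%n⇒j≡[i+s]%n : ∀ n .{{_ : NonZero n}} {i j} s → i < n → j < n →
  ((n + j) ∸ i) % n ≡ s % n → j ≡ (i + s) % n
[n+j∸i]%n≡s%n⇒j≡[i+s]%n n {i} {j} s i<n j<n eq = ≡.sym (begin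
  (i + s) % n                       ≡⟨ %-distribˡ-+ i s n ⟩
  (i % n + s % n) % n               ≡⟨ ≡.cong (λ z → (i % n + z) % n) (≡.sym eq) ⟩
  (i % n + ((n + j) ∸ i) % n) % n   ≡⟨ %-distribˡ-+ i ((n + j) ∸ i) n ⟨
  (i + ((n + j) ∸ i)) % n           ≡⟨ ≡.cong (_% n) (m+[n∸m]≡n (≤-trans (<⇒≤ i<n) (m≤m+n n j))) ⟩
  (n + j) % n                       ≡⟨ ≡.cong (_% n) (+-comm n j) ⟩
  (j + n) % n                       ≡⟨ [m+n]%n≡m%n j n ⟩
  j % n                             ≡⟨ m<n⇒m%n≡m j<n ⟩
  j                                 ∎)
  where open ≡.≡-Reasoning

-- 0-based: row i of D_k is supported on column (i + 1) + (k + 1) − 1.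
Dk-column : ∀ m → Fin (suc m) → Fin (suc m) → Fin (suc m)
Dk-column m k i = (toℕ i + suc (toℕ k)) mod suc m

Dk-column-comm : ∀ m k k′ → Dk-column m k′ k ≡ Dk-column m k k′
Dk-column-comm m k k′ = ≡.cong (_mod suc m) (begin
  toℕ k + suc (toℕ k′)   ≡⟨ +-suc (toℕ k) (toℕ k′) ⟩
  suc (toℕ k + toℕ k′)   ≡⟨ ≡.cong suc (+-comm (toℕ k) (toℕ k′)) ⟩
  suc (toℕ k′ + toℕ k)   ≡⟨ +-suc (toℕ k′) (toℕ k) ⟨
  toℕ k′ + suc (toℕ k)   ∎)
  where open ≡.≡-Reasoning

Dk-condition⇒column : ∀ m {k i j : Fin (suc m)} →
  ((suc m + toℕ j) ∸ toℕ i) mod suc m ≡ suc (toℕ k) mod suc m → j ≡ Dk-column m k i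
Dk-condition⇒column m {k} {i} {j} eq = toℕ-injective (begin
  toℕ j
    ≡⟨ [n+j∸i]%n≡s%n⇒j≡[i+s]%n (suc m) (suc (toℕ k)) (toℕ<n i) (toℕ<n j) eq′ ⟩
  (toℕ i + suc (toℕ k)) % suc m      ≡⟨ toℕ-mod (toℕ i + suc (toℕ k)) (suc m) ⟨
  toℕ (Dk-column m k i)              ∎)
  where
  open ≡.≡-Reasoning
  eq′ : ((suc m + toℕ j) ∸ toℕ i) % suc m ≡ suc (toℕ k) % suc m
  eq′ = begin
    ((suc m + toℕ j) ∸ toℕ i) % suc m        ≡⟨ toℕ-mod ((suc m + toℕ j) ∸ toℕ i) (suc m) ⟨
    toℕ (((suc m + toℕ j) ∸ toℕ i) mod suc m) ≡⟨ ≡.cong toℕ eq ⟩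
    toℕ (suc (toℕ k) mod suc m)               ≡⟨ toℕ-mod (suc (toℕ k)) (suc m) ⟩
    suc (toℕ k) % suc m                      ∎

module _ {c ℓ : Level} (R : CommutativeRing c ℓ) where
  open CommutativeRing R
  open import Algebra.Properties.Ring ring using (-0#≈0#)
  open import Algebra.Properties.CommutativeSemigroup *-commutativeSemigroup
    using (x∙yz≈y∙xz)
  open import Relation.Binary.Reasoning.Setoid setoid

  ZeroRow : ∀ {n} → Mat R n → Fin n → Set ℓ
  ZeroRow Z i = ∀ t → Z i t ≈ 0#

  RowSupportedAt : ∀ {n} → Mat R n → Fin n → Fin n → Set ℓ
  RowSupportedAt Z i col = ∀ t → t ≢ col → Z i t ≈ 0#

  x-0#≈x : ∀ x → x - 0# ≈ x
  x-0#≈x x = trans (+-congˡ -0#≈0#) (+-identityʳ x)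

  ∑-cong : ∀ {n} {f g : Fin n → Carrier} → (∀ t → f t ≈ g t) → ∑ R f ≈ ∑ R g
  ∑-cong {zero}  f≈g = refl
  ∑-cong {suc n} f≈g = +-cong (f≈g fzero) (∑-cong (λ t → f≈g (fsuc t)))

  ∑-zero : ∀ {n} {f : Fin n → Carrier} → (∀ t → f t ≈ 0#) → ∑ R f ≈ 0#
  ∑-zero {zero}  f≈0 = refl
  ∑-zero {suc n} f≈0 = trans (+-cong (f≈0 fzero) (∑-zero (λ t → f≈0 (fsuc t)))) (+-identityʳ 0#)

  ∑-single : ∀ {n} {f : Fin n → Carrier} col → (∀ t → t ≢ col → f t ≈ 0#) → ∑ R f ≈ f col
  ∑-single {suc n} fzero f≈0 =
    trans (+-congˡ (∑-zero (λ t → f≈0 (fsuc t) λ ()))) (+-identityʳ _)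
  ∑-single {suc n} (fsuc col) f≈0 =
    trans (+-cong (f≈0 fzero λ ()) (∑-single col λ t t≢col → f≈0 (fsuc t) (t≢col ∘ suc-injective)))
          (+-identityˡ _)

  Iᴹ-diag : ∀ {n} (i : Fin n) → Iᴹ R i i ≈ 1#
  Iᴹ-diag i with i ≟ᶠ i
  ... | yes _   = refl
  ... | no i≢i = ⊥-elim (i≢i ≡.refl)

  Iᴹ-offDiag : ∀ {n} {i j : Fin n} → i ≢ j → Iᴹ R i j ≈ 0#
  Iᴹ-offDiag {i = i} {j} i≢j with i ≟ᶠ j
  ... | yes i≡j = ⊥-elim (i≢j i≡j)
  ... | no _    = refl

  *ᴹ-cong : ∀ {n} {X X′ Y Y′ : Mat R n} → _≈ᴹ_ R X X′ → _≈ᴹ_ R Y Y′ →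
    _≈ᴹ_ R (_*ᴹ_ R X Y) (_*ᴹ_ R X′ Y′)
  *ᴹ-cong X≈X′ Y≈Y′ i j = ∑-cong (λ t → *-cong (X≈X′ i t) (Y≈Y′ t j))

  -ᴹ-cong : ∀ {n} {X X′ Y Y′ : Mat R n} → _≈ᴹ_ R X X′ → _≈ᴹ_ R Y Y′ →
    _≈ᴹ_ R (_-ᴹ_ R X Y) (_-ᴹ_ R X′ Y′)
  -ᴹ-cong X≈X′ Y≈Y′ i j = +-cong (X≈X′ i j) (-‿cong (Y≈Y′ i j))

  Invertible-resp-≈ᴹ : ∀ {n} {X Y : Mat R n} → _≈ᴹ_ R X Y → Invertible R X → Invertible R Y
  Invertible-resp-≈ᴹ {X = X} {Y} X≈Y (W , XW≈I , WX≈I) =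
    W , (λ i j → trans (*ᴹ-cong {X = Y} {X} {W} {W} Y≈X (λ _ _ → refl) i j) (XW≈I i j))
      , (λ i j → trans (*ᴹ-cong {X = W} {W} {Y} {X} (λ _ _ → refl) Y≈X i j) (WX≈I i j))
    where
    Y≈X : _≈ᴹ_ R Y X
    Y≈X i j = sym (X≈Y i j)

  *ᴹ-rowSupportedAt : ∀ {n} {Z : Mat R n} {i col} → RowSupportedAt Z i col →
    ∀ W j → _*ᴹ_ R Z W i j ≈ Z i col * W col j
  *ᴹ-rowSupportedAt Zᵢ≈0 W j = ∑-single _ (λ t t≢col → trans (*-congʳ (Zᵢ≈0 t t≢col)) (zeroˡ _))

  zeroRow⇒¬rightInverse : ∀ {n} {Z W : Mat R n} {i} → ¬ 1# ≈ 0# →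
    ZeroRow Z i → ¬ _≈ᴹ_ R (_*ᴹ_ R Z W) (Iᴹ R)
  zeroRow⇒¬rightInverse {Z = Z} {W} {i} 1≉0 Zᵢ≈0 ZW≈I = 1≉0 (begin
    1#                   ≈⟨ Iᴹ-diag i ⟨
    Iᴹ R i i             ≈⟨ ZW≈I i i ⟨
    _*ᴹ_ R Z W i i       ≈⟨ ∑-zero (λ t → trans (*-congʳ (Zᵢ≈0 t)) (zeroˡ _)) ⟩
    0#                   ∎)

  -- Rows i and i′ of Z W would be the multiples u · W col and v · W col of a single row.
  commonColumn⇒¬rightInverse : ∀ {n} {Z W : Mat R n} {i i′ col} → ¬ 1# ≈ 0# → i ≢ i′ →
    RowSupportedAt Z i col → RowSupportedAt Z i′ col → ¬ _≈ᴹ_ R (_*ᴹ_ R Z W) (Iᴹ R)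
  commonColumn⇒¬rightInverse {Z = Z} {W} {i} {i′} {col} 1≉0 i≢i′ Zᵢ Zᵢ′ ZW≈I =
    1≉0 (begin
      1#               ≈⟨ Iᴹ-diag i′ ⟨
      Iᴹ R i′ i′       ≈⟨ rowᵢ′ i′ ⟩
      v * W col i′     ≈⟨ *-congʳ v≈0 ⟩
      0# * W col i′    ≈⟨ zeroˡ _ ⟩
      0#               ∎)
    where
    u = Z i col
    v = Z i′ col

    rowᵢ : ∀ j → Iᴹ R i j ≈ u * W col j
    rowᵢ j = trans (sym (ZW≈I i j)) (*ᴹ-rowSupportedAt {Z = Z} Zᵢ W j)

    rowᵢ′ : ∀ j → Iᴹ R i′ j ≈ v * W col j
    rowᵢ′ j = trans (sym (ZW≈I i′ j)) (*ᴹ-rowSupportedAt {Z = Z} Zᵢ′ W j)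

    v≈0 : v ≈ 0#
    v≈0 = begin
      v                    ≈⟨ *-identityʳ v ⟨
      v * 1#               ≈⟨ *-congˡ (trans (sym (Iᴹ-diag i)) (rowᵢ i)) ⟩
      v * (u * W col i)    ≈⟨ x∙yz≈y∙xz v u (W col i) ⟩
      u * (v * W col i)    ≈⟨ *-congˡ (trans (sym (rowᵢ′ i)) (Iᴹ-offDiag (≢-sym i≢i′))) ⟩
      u * 0#               ≈⟨ zeroʳ u ⟩
      0#                   ∎

  -ᴹ-zeroRow : ∀ {n} {X Y : Mat R n} {i} → ZeroRow X i → ZeroRow Y i → ZeroRow (_-ᴹ_ R X Y) i
  -ᴹ-zeroRow Xᵢ≈0 Yᵢ≈0 t = trans (+-cong (Xᵢ≈0 t) (-‿cong (Yᵢ≈0 t))) (x-0#≈x 0#)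

  -ᴹ-rowSupportedAt : ∀ {n} {X Y : Mat R n} {i col} →
    RowSupportedAt X i col → RowSupportedAt Y i col → RowSupportedAt (_-ᴹ_ R X Y) i col
  -ᴹ-rowSupportedAt Xᵢ Yᵢ t t≢col =
    trans (+-cong (Xᵢ t t≢col) (-‿cong (Yᵢ t t≢col))) (x-0#≈x 0#)

  zeroRow⇒rowSupportedAt : ∀ {n} {Z : Mat R n} {i} col → ZeroRow Z i → RowSupportedAt Z i col
  zeroRow⇒rowSupportedAt _ Zᵢ≈0 t _ = Zᵢ≈0 t

  Dk-zeroRow : ∀ m k a → ZeroRow (Dk R m k a) k
  Dk-zeroRow m k a t with k ≟ᶠ k
  ... | yes _   = refl
  ... | no k≢k = ⊥-elim (k≢k ≡.refl)

  Dk-rowSupportedAt : ∀ m k a i → RowSupportedAt (Dk R m k a) i (Dk-column m k i)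
  Dk-rowSupportedAt m k a i j j≢col with i ≟ᶠ k
  ... | yes _ = refl
  ... | no _ with ((suc m ℕ.+ toℕ j) ℕ.∸ toℕ i) mod suc m ≟ᶠ suc (toℕ k) mod suc m
  ... | no _    = refl
  ... | yes eq  = ⊥-elim (j≢col (Dk-condition⇒column m {k} {i} {j} eq))

  Dk-ᴹ-Dk-¬invertible : ¬ 1# ≈ 0# → ∀ m k k′ a b →
    ¬ Invertible R (_-ᴹ_ R (Dk R m k a) (Dk R m k′ b))
  Dk-ᴹ-Dk-¬invertible 1≉0 m k k′ a b (W , ZW≈I , _) with k ≟ᶠ k′
  ... | yes ≡.refl = zeroRow⇒¬rightInverse {Z = Z} {W} {k} 1≉0
    (-ᴹ-zeroRow {X = Dk R m k a} {Dk R m k b} {k} (Dk-zeroRow m k a) (Dk-zeroRow m k b)) ZW≈I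
    where Z = _-ᴹ_ R (Dk R m k a) (Dk R m k b)
  ... | no k≢k′ =
    commonColumn⇒¬rightInverse {Z = Z} {W} {k} {k′} {Dk-column m k′ k} 1≉0 k≢k′ rowₖ rowₖ′ ZW≈I
    where
    Z = _-ᴹ_ R (Dk R m k a) (Dk R m k′ b)

    rowₖ : RowSupportedAt Z k (Dk-column m k′ k)
    rowₖ = -ᴹ-rowSupportedAt {X = Dk R m k a} {Dk R m k′ b} {k}
      (zeroRow⇒rowSupportedAt {Z = Dk R m k a} {k} _ (Dk-zeroRow m k a))
      (Dk-rowSupportedAt m k′ b k)

    rowₖ′ : RowSupportedAt Z k′ (Dk-column m k′ k)
    rowₖ′ rewrite Dk-column-comm m k k′ = -ᴹ-rowSupportedAt {X = Dk R m k a} {Dk R m k′ b} {k′}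
      (Dk-rowSupportedAt m k a k′)
      (zeroRow⇒rowSupportedAt {Z = Dk R m k′ b} {k′} _ (Dk-zeroRow m k′ b))

lemma2p4 : {c ℓ : Level} (F : CommutativeRing c ℓ) → IsField F → IsFinite F →
    (m : ℕ) → IsIndependent F (suc m) (In𝒟 F m)
lemma2p4 F isField _ m X Y (k , a , X≈Dₖa) (k′ , b , Y≈Dₖ′b) (_ , X-Y-invertible) =
  Dk-ᴹ-Dk-¬invertible F (IsField.1≉0 isField) m k k′ a b
    (Invertible-resp-≈ᴹ F (-ᴹ-cong F X≈Dₖa Y≈Dₖ′b) X-Y-invertible)
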